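{- Let $\Gamma=(P,L,I)$ be a rank $2$ incidence geometry and let $\lambda,k_1,k_2,l\in\mathbb{N}$ satisfy $k_1+k_2-\lambda\geq l$. Suppose that at some point of the pebble game on $\Gamma$ all edges of $I_\lambda(\Gamma)$ (i.e. all edges associated to incidences of $\Gamma$) have been accepted. Then $\Gamma$ is $(\lambda,k_1,k_2,l)$-sparse. If moreover at that point exactly $l$ pebbles remain in total, i.e. $\sum_{v\in P\cup L}\mathrm{peb}(v)=l$, then $\Gamma$ is $(\lambda,k_1,k_2,l)$-tight.
   Context: A rank $2$ incidence geometry is a triple $\Gamma=(P,L,I)$ with $P$ (points) and $L$ (lines) finite disjoint sets and $I\subseteq P\times L$. For $I'\subseteq I$, its support is $P(I')\times L(I')$ where $P(I')=\{p:\exists \ell,\ (p,\ell)\in I'\}$ and $L(I')=\{\ell:\exists p,\ (p,\ell)\in I'\}$. $\Gamma$ is $(\lambda,k_1,k_2,l)$-sparse if for every nonempty $I'\subseteq I$, $\lambda|I'|\leq k_1|P(I')|+k_2|L(I')|-l$; it is $(\lambda,k_1,k_2,l)$-tight if it is sparse and $\lambda|I|=k_1|P|+k_2|L|-l$. Pebble game. Let $I_\lambda(\Gamma)$ be the multigraph with vertex set $P\cup L$ and edge set $\{(p,\ell,i): (p,\ell)\in I,\ i\in\{1,\dots,\lambda\}\}$, the edge $(p,\ell,i)$ having endpoints $p,\ell$ and being associated to the incidence $(p,\ell)$. Set $\tau(v)=1$ for $v\in P$, $\tau(v)=2$ for $v\in L$. The game maintains a directed multigraph $D$ on $P\cup L$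 whose edges (accepted edges) are a subset of the edges of $I_\lambda(\Gamma)$, each oriented, and a pebble count $\mathrm{peb}(v)\in\mathbb{N}$ at each vertex. Initially $D$ is empty and $\mathrm{peb}(v)=k_{\tau(v)}$. Legal moves: - $\textbf{Accept-Edge}(e)$: if $e=(v,w,i)$ is not in $D$ and $\mathrm{peb}(v)+\mathrm{peb}(w)>l$, remove a pebble from an endpoint $x\in\{v,w\}$ with $\mathrm{peb}(x)>0$ and add $e$ to $D$ oriented from $x$ to the other endpoint. - $\textbf{Move-Pebble}(v\leftarrow w)$: if there is a directed path in $D$ from $v$ to $w$ and $\mathrm{peb}(w)>0$, add a pebble to $v$, remove one from $w$, and reverse every edge of the path. "A point of the game" means the configuration after any finite sequence of legal moves from the initial configuration. -}

module Defs where

open import Data.Nat using (ℕ; zero; suc; _+_; _*_; _≤_; _<_; pred)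
open import Data.Bool using (Bool; true; false; if_then_else_; _∧_; _∨_)
open import Data.Fin using (Fin; zero; suc)
import Data.Fin as F
open import Data.Sum using (_⊎_; inj₁; inj₂)
open import Data.Product using (_×_; _,_; ∃; Σ)
open import Data.List using (List; []; _∷_)
open import Data.List.Relation.Unary.Unique.Propositional using (Unique)
open import Relation.Binary.PropositionalEquality using (_≡_; _≢_)
open import Relation.Nullary.Decidable using (⌊_⌋)

countFin : ∀ {n} → (Fin n → Bool) → ℕ
countFin {zero}  f = 0
countFin {suc n} f = (if f zero then 1 else 0) + countFin (λ i → f (suc i))

sumFin : ∀ {n} → (Fin n → ℕ) → ℕ
sumFin {zero}  f = 0
sumFin {suc n} f = f zero + sumFin (λ i → f (suc i))

anyFin : ∀ {n} → (Fin n → Bool) → Bool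
anyFin {zero}  f = false
anyFin {suc n} f = f zero ∨ anyFin (λ i → f (suc i))

Incidence : ℕ → ℕ → Set
Incidence np nl = Fin np → Fin nl → Bool

_⊆I_ : ∀ {np nl} → Incidence np nl → Incidence np nl → Set
I' ⊆I I = ∀ p ℓ → I' p ℓ ≡ true → I p ℓ ≡ true

NonEmpty : ∀ {np nl} → Incidence np nl → Set
NonEmpty I' = ∃ λ p → ∃ λ ℓ → I' p ℓ ≡ true

card : ∀ {np nl} → Incidence np nl → ℕ
card I' = sumFin (λ p → countFin (I' p))

cardP : ∀ {np nl} → Incidence np nl → ℕ
cardP I' = countFin (λ p → anyFin (λ ℓ → I' p ℓ))

cardL : ∀ {np nl} → Incidence np nl → ℕ
cardL I' = countFin (λ ℓ → anyFin (λ p → I' p ℓ))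

-- (λ,k₁,k₂,l)-sparse:  λ|I'| ≤ k₁|P(I')| + k₂|L(I')| - l  (in ℤ),
-- written equivalently without subtraction as  λ|I'| + l ≤ k₁|P(I')| + k₂|L(I')|.
Sparse : ∀ np nl → Incidence np nl → (lam k₁ k₂ l : ℕ) → Set
Sparse np nl I lam k₁ k₂ l =
  (I' : Incidence np nl) → I' ⊆I I → NonEmpty I' →
  lam * card I' + l ≤ k₁ * cardP I' + k₂ * cardL I'

-- (λ,k₁,k₂,l)-tight: sparse and λ|I| = k₁|P| + k₂|L| - l (again as λ|I| + l = …)
Tight : ∀ np nl → Incidence np nl → (lam k₁ k₂ l : ℕ) → Set
Tight np nl I lam k₁ k₂ l =
  Sparse np nl I lam k₁ k₂ l × (lam * card I + l ≡ k₁ * np + k₂ * nl)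

Vertex : ℕ → ℕ → Set
Vertex np nl = Fin np ⊎ Fin nl

_≟V_ : ∀ {np nl} → Vertex np nl → Vertex np nl → Bool
inj₁ a ≟V inj₁ b = ⌊ a F.≟ b ⌋
inj₁ a ≟V inj₂ b = false
inj₂ a ≟V inj₁ b = false
inj₂ a ≟V inj₂ b = ⌊ a F.≟ b ⌋

-- status of the edge (p,ℓ,i) of I_λ(Γ) in D
data Orient : Set where
  unaccepted : Orient
  pt→ln      : Orient
  ln→pt      : Orient

flip : Orient → Orient
flip unaccepted = unaccepted
flip pt→ln = ln→pt
flip ln→pt = pt→ln

record Config (np nl lam : ℕ) : Set where
  constructor config
  field
    orient : Fin np → Fin nl → Fin lam → Orient
    peb    : Vertex np nl → ℕ
open Config public

Edge : ℕ → ℕ → ℕ → Set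
Edge np nl lam = Fin np × Fin nl × Fin lam

_≟E_ : ∀ {np nl lam} → Edge np nl lam → Edge np nl lam → Bool
(p , ℓ , i) ≟E (p' , ℓ' , i') = ⌊ p F.≟ p' ⌋ ∧ (⌊ ℓ F.≟ ℓ' ⌋ ∧ ⌊ i F.≟ i' ⌋)

elemE : ∀ {np nl lam} → Edge np nl lam → List (Edge np nl lam) → Bool
elemE e []       = false
elemE e (x ∷ xs) = (e ≟E x) ∨ elemE e xs

incr : ∀ {np nl} → Vertex np nl → (Vertex np nl → ℕ) → Vertex np nl → ℕ
incr v f x = if x ≟V v then suc (f x) else f x

decr : ∀ {np nl} → Vertex np nl → (Vertex np nl → ℕ) → Vertex np nl → ℕ
decr v f x = if x ≟V v then pred (f x) else f x

data Arc {np nl lam} (c : Config np nl lam) : Vertex np nl → Vertex np nl → Set where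
  arcPL : (p : Fin np) (ℓ : Fin nl) (i : Fin lam) → orient c p ℓ i ≡ pt→ln →
          Arc c (inj₁ p) (inj₂ ℓ)
  arcLP : (p : Fin np) (ℓ : Fin nl) (i : Fin lam) → orient c p ℓ i ≡ ln→pt →
          Arc c (inj₂ ℓ) (inj₁ p)

arcEdge : ∀ {np nl lam} {c : Config np nl lam} {u w} → Arc c u w → Edge np nl lam
arcEdge (arcPL p ℓ i _) = p , ℓ , i
arcEdge (arcLP p ℓ i _) = p , ℓ , i

data Walk {np nl lam} (c : Config np nl lam) : Vertex np nl → Vertex np nl → Set where
  []  : ∀ {u} → Walk c u u
  _∷_ : ∀ {u v w} → Arc c u v → Walk c v w → Walk c u w

walkVerts : ∀ {np nl lam} {c : Config np nl lam} {u w} → Walk c u w → List (Vertex np nl)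
walkVerts {u = u} []       = u ∷ []
walkVerts {u = u} (a ∷ ws) = u ∷ walkVerts ws

walkEdges : ∀ {np nl lam} {c : Config np nl lam} {u w} → Walk c u w → List (Edge np nl lam)
walkEdges []       = []
walkEdges (a ∷ ws) = arcEdge a ∷ walkEdges ws

IsPath : ∀ {np nl lam} {c : Config np nl lam} {u w} → Walk c u w → Set
IsPath ws = Unique (walkVerts ws)

reverseAlong : ∀ {np nl lam} → List (Edge np nl lam) →
               (Fin np → Fin nl → Fin lam → Orient) → Fin np → Fin nl → Fin lam → Orient
reverseAlong es o p ℓ i = if elemE (p , ℓ , i) es then flip (o p ℓ i) else o p ℓ i

initial : ∀ np nl lam (k₁ k₂ : ℕ) → Config np nl lam
initial np nl lam k₁ k₂ = config (λ _ _ _ → unaccepted) pebs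
  where
  pebs : Vertex np nl → ℕ
  pebs (inj₁ _) = k₁
  pebs (inj₂ _) = k₂

data Move {np nl lam} (I : Incidence np nl) (l : ℕ) :
          Config np nl lam → Config np nl lam → Set where
  acceptFromPoint : ∀ c p ℓ i → I p ℓ ≡ true → orient c p ℓ i ≡ unaccepted →
    l < peb c (inj₁ p) + peb c (inj₂ ℓ) → 0 < peb c (inj₁ p) →
    Move I l c (config (λ p' ℓ' i' → if (p' , ℓ' , i') ≟E (p , ℓ , i)
                                        then pt→ln else orient c p' ℓ' i')
                       (decr (inj₁ p) (peb c)))
  acceptFromLine : ∀ c p ℓ i → I p ℓ ≡ true → orient c p ℓ i ≡ unaccepted →
    l < peb c (inj₁ p) + peb c (inj₂ ℓ) → 0 < peb c (inj₂ ℓ) →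
    Move I l c (config (λ p' ℓ' i' → if (p' , ℓ' , i') ≟E (p , ℓ , i)
                                        then ln→pt else orient c p' ℓ' i')
                       (decr (inj₂ ℓ) (peb c)))
  movePebble : ∀ c v w (π : Walk c v w) → IsPath π → 0 < peb c w →
    Move I l c (config (reverseAlong (walkEdges π) (orient c))
                       (incr v (decr w (peb c))))

-- configurations reachable by finitely many legal moves ("points of the game")
data Reachable {np nl lam} (I : Incidence np nl) (k₁ k₂ l : ℕ) :
               Config np nl lam → Set where
  start : Reachable I k₁ k₂ l (initial np nl lam k₁ k₂)
  step  : ∀ {c c'} → Reachable I k₁ k₂ l c → Move I l c c' → Reachable I k₁ k₂ l c'

AllAccepted : ∀ {np nl lam} → Incidence np nl → Config np nl lam → Set
AllAccepted I c = ∀ p ℓ i → I p ℓ ≡ true → orient c p ℓ i ≢ unaccepted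

totalPebbles : ∀ {np nl lam} → Config np nl lam → ℕ
totalPebbles {np} {nl} c = sumFin (λ p → peb c (inj₁ p)) + sumFin (λ ℓ → peb c (inj₂ ℓ))

-- For a set S of vertices, count the pebbles on S, the accepted edges with tail in S,
-- and the accepted edges spanned by S.  Every move preserves
--   (tails in S) + (pebbles on S) = k₁|S ∩ P| + k₂|S ∩ L|,
-- and, whenever S spans an accepted edge,
--   (edges spanned by S) + l ≤ k₁|S ∩ P| + k₂|S ∩ L|,
-- the latter because an edge is only accepted while its endpoints carry more than l pebbles.
-- Once every edge is accepted, S = P(I') ∪ L(I') gives sparsity, and S = P ∪ L with
-- l pebbles left gives λ|I| + l = k₁|P| + k₂|L|.

module Submission where

open import Defs
open import Data.Nat using (ℕ; zero; suc; _+_; _*_; _≤_; _<_; pred; z≤n; s≤s; >-nonZero)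
open import Data.Nat.Properties
open import Algebra.Properties.CommutativeSemigroup +-commutativeSemigroup
  using (interchange; xy∙z≈xz∙y)
open import Data.Bool using (Bool; true; false; if_then_else_; _∧_; _∨_)
open import Data.Bool.Properties using (∨-zeroʳ)
open import Data.Fin using (Fin; zero; suc)
import Data.Fin as F
import Data.Fin.Properties as Fin
open import Data.Sum using (inj₁; inj₂)
open import Data.Sum.Properties using (inj₁-injective; inj₂-injective)
open import Data.Product using (_×_; _,_; proj₁; proj₂)
open import Data.List using (List; []; _∷_)
open import Data.List.Membership.Propositional using (_∈_)
open import Data.List.Relation.Unary.Any using (here; there)
open import Data.List.Relation.Unary.All using (All; lookup)
open import Data.List.Relation.Unary.AllPairs using (_∷_)
open import Function using (_∘_)
open import Relation.Binary.PropositionalEquality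
open import Relation.Nullary using (yes; no; contradiction)
open import Relation.Nullary.Decidable using (⌊_⌋)

private
  variable
    n np nl lam : ℕ

χ : Bool → ℕ
χ b = if b then 1 else 0

+-exchange : ∀ {a b c d x y} → a + x ≡ b + y → c + y ≡ d + x → a + c ≡ b + d
+-exchange {a} {b} {c} {d} {x} {y} a+x≡b+y c+y≡d+x = +-cancelʳ-≡ (x + y) _ _ (begin
  a + c + (x + y)  ≡⟨ interchange a c x y ⟩
  a + x + (c + y)  ≡⟨ cong₂ _+_ a+x≡b+y c+y≡d+x ⟩
  b + y + (d + x)  ≡⟨ interchange b y d x ⟩
  b + d + (y + x)  ≡⟨ cong (b + d +_) (+-comm y x) ⟩
  b + d + (x + y)  ∎)
  where open ≡-Reasoning

bounded-by-span : ∀ {x s l cap} → x ≤ s → l ≤ cap → (1 ≤ s → s + l ≤ cap) → x + l ≤ cap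
bounded-by-span {s = zero}  z≤n l≤cap _     = l≤cap
bounded-by-span {s = suc s} x≤s _     bound = ≤-trans (+-monoˡ-≤ _ x≤s) (bound (s≤s z≤n))

sumFin-cong : {f g : Fin n → ℕ} → (∀ i → f i ≡ g i) → sumFin f ≡ sumFin g
sumFin-cong {zero}  f≗g = refl
sumFin-cong {suc n} f≗g = cong₂ _+_ (f≗g zero) (sumFin-cong (f≗g ∘ suc))

sumFin-mono : {f g : Fin n → ℕ} → (∀ i → f i ≤ g i) → sumFin f ≤ sumFin g
sumFin-mono {zero}  f≤g = z≤n
sumFin-mono {suc n} f≤g = +-mono-≤ (f≤g zero) (sumFin-mono (f≤g ∘ suc))

sumFin-zero : ∀ n → sumFin {n} (λ _ → 0) ≡ 0
sumFin-zero zero    = refl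
sumFin-zero (suc n) = sumFin-zero n

sumFin-const : ∀ n k → sumFin {n} (λ _ → k) ≡ n * k
sumFin-const zero    k = refl
sumFin-const (suc n) k = cong (k +_) (sumFin-const n k)

*-sumFin : ∀ k (f : Fin n → ℕ) → k * sumFin f ≡ sumFin (λ i → k * f i)
*-sumFin {zero}  k f = *-zeroʳ k
*-sumFin {suc n} k f =
  trans (*-distribˡ-+ k (f zero) _) (cong (k * f zero +_) (*-sumFin k (f ∘ suc)))

selected≤sumFin : (b : Fin n → Bool) (f : Fin n → ℕ) (j : Fin n) → b j ≡ true →
                  f j ≤ sumFin (λ i → if b i then f i else 0)
selected≤sumFin b f zero    bj rewrite bj = m≤m+n _ _
selected≤sumFin b f (suc j) bj = ≤-trans (selected≤sumFin (b ∘ suc) (f ∘ suc) j bj) (m≤n+m _ _)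

sumFin-update : ∀ {f g : Fin n → ℕ} {a b} j → (∀ i → i ≢ j → f i ≡ g i) →
                f j + a ≡ g j + b → sumFin f + a ≡ sumFin g + b
sumFin-update {f = f} {g} {a} {b} zero off at-j = begin
  f zero + sumFin (f ∘ suc) + a  ≡⟨ xy∙z≈xz∙y (f zero) _ a ⟩
  f zero + a + sumFin (f ∘ suc)  ≡⟨ cong₂ _+_ at-j (sumFin-cong (λ i → off (suc i) λ ())) ⟩
  g zero + b + sumFin (g ∘ suc)  ≡⟨ xy∙z≈xz∙y (g zero) b _ ⟩
  g zero + sumFin (g ∘ suc) + b  ∎
  where open ≡-Reasoning
sumFin-update {f = f} {g} {a} {b} (suc j) off at-j = begin
  f zero + sumFin (f ∘ suc) + a    ≡⟨ +-assoc (f zero) _ a ⟩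
  f zero + (sumFin (f ∘ suc) + a)  ≡⟨ cong₂ _+_ (off zero λ ()) (sumFin-update j off-tail at-j) ⟩
  g zero + (sumFin (g ∘ suc) + b)  ≡⟨ +-assoc (g zero) _ b ⟨
  g zero + sumFin (g ∘ suc) + b    ∎
  where
  open ≡-Reasoning
  off-tail : ∀ i → i ≢ j → f (suc i) ≡ g (suc i)
  off-tail i i≢j = off (suc i) (i≢j ∘ Fin.suc-injective)

countFin≡sumFin-χ : (f : Fin n → Bool) → countFin f ≡ sumFin (χ ∘ f)
countFin≡sumFin-χ {zero}  f = refl
countFin≡sumFin-χ {suc n} f = cong (χ (f zero) +_) (countFin≡sumFin-χ (f ∘ suc))

sumFin-if≡*-countFin : (f : Fin n → Bool) (k : ℕ) →
                       sumFin (λ i → if f i then k else 0) ≡ k * countFin f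
sumFin-if≡*-countFin {zero}  f k = sym (*-zeroʳ k)
sumFin-if≡*-countFin {suc n} f k with f zero
... | true  = trans (cong (k +_) (sumFin-if≡*-countFin (f ∘ suc) k)) (sym (*-suc k _))
... | false = sumFin-if≡*-countFin (f ∘ suc) k

countFin-true : ∀ n → countFin {n} (λ _ → true) ≡ n
countFin-true zero    = refl
countFin-true (suc n) = cong suc (countFin-true n)

1≤countFin : (f : Fin n → Bool) (j : Fin n) → f j ≡ true → 1 ≤ countFin f
1≤countFin f zero    fj rewrite fj = s≤s z≤n
1≤countFin f (suc j) fj = ≤-trans (1≤countFin (f ∘ suc) j fj) (m≤n+m _ _)

anyFin-witness : (f : Fin n → Bool) (j : Fin n) → f j ≡ true → anyFin f ≡ true
anyFin-witness f zero    fj rewrite fj = refl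
anyFin-witness f (suc j) fj =
  trans (cong (f zero ∨_) (anyFin-witness (f ∘ suc) j fj)) (∨-zeroʳ (f zero))

⌊≟⌋-refl : (a : Fin n) → ⌊ a F.≟ a ⌋ ≡ true
⌊≟⌋-refl a with a F.≟ a
... | yes _   = refl
... | no a≢a = contradiction refl a≢a

⌊≟⌋-true⇒≡ : {a b : Fin n} → ⌊ a F.≟ b ⌋ ≡ true → a ≡ b
⌊≟⌋-true⇒≡ {a = a} {b} h with a F.≟ b
... | yes a≡b = a≡b
... | no _    = contradiction h λ ()

≟V-refl : (v : Vertex np nl) → v ≟V v ≡ true
≟V-refl (inj₁ p) = ⌊≟⌋-refl p
≟V-refl (inj₂ ℓ) = ⌊≟⌋-refl ℓ

≟V-true⇒≡ : {x v : Vertex np nl} → x ≟V v ≡ true → x ≡ v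
≟V-true⇒≡ {x = inj₁ p} {inj₁ q} h = cong inj₁ (⌊≟⌋-true⇒≡ h)
≟V-true⇒≡ {x = inj₂ ℓ} {inj₂ m} h = cong inj₂ (⌊≟⌋-true⇒≡ h)
≟V-true⇒≡ {x = inj₁ p} {inj₂ m} ()
≟V-true⇒≡ {x = inj₂ ℓ} {inj₁ q} ()

≟E-refl : (e : Edge np nl lam) → e ≟E e ≡ true
≟E-refl (p , ℓ , i) rewrite ⌊≟⌋-refl p | ⌊≟⌋-refl ℓ | ⌊≟⌋-refl i = refl

≟E-true⇒≡ : {e e' : Edge np nl lam} → e ≟E e' ≡ true → e ≡ e'
≟E-true⇒≡ {e = p , ℓ , i} {p' , ℓ' , i'} h with p F.≟ p' | ℓ F.≟ ℓ' | i F.≟ i'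
... | yes refl | yes refl | yes refl = refl
... | no _     | _        | _        = contradiction h λ ()
... | yes _    | no _     | _        = contradiction h λ ()
... | yes _    | yes _    | no _     = contradiction h λ ()

if-≟V-off : ∀ {A : Set} {x v : Vertex np nl} {a b : A} → x ≢ v → (if x ≟V v then a else b) ≡ b
if-≟V-off {x = x} {v} x≢v with x ≟V v in eq
... | true  = contradiction (≟V-true⇒≡ eq) x≢v
... | false = refl

if-≟E-off : ∀ {A : Set} {e e' : Edge np nl lam} {a b : A} → e' ≢ e → (if e' ≟E e then a else b) ≡ b
if-≟E-off {e = e} {e'} e'≢e with e' ≟E e in eq
... | true  = contradiction (≟E-true⇒≡ eq) e'≢e
... | false = refl

sumV : (Vertex np nl → ℕ) → ℕ
sumV f = sumFin (f ∘ inj₁) + sumFin (f ∘ inj₂)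

sumV-update : ∀ {f g : Vertex np nl → ℕ} {a b} v → (∀ x → x ≢ v → f x ≡ g x) →
              f v + a ≡ g v + b → sumV f + a ≡ sumV g + b
sumV-update {f = f} {g} {a} {b} (inj₁ p) off at-v = begin
  sumFin (f ∘ inj₁) + sumFin (f ∘ inj₂) + a  ≡⟨ xy∙z≈xz∙y (sumFin (f ∘ inj₁)) _ a ⟩
  sumFin (f ∘ inj₁) + a + sumFin (f ∘ inj₂)  ≡⟨ cong₂ _+_ points lines ⟩
  sumFin (g ∘ inj₁) + b + sumFin (g ∘ inj₂)  ≡⟨ xy∙z≈xz∙y (sumFin (g ∘ inj₁)) b _ ⟩
  sumFin (g ∘ inj₁) + sumFin (g ∘ inj₂) + b  ∎
  where
  open ≡-Reasoning
  points = sumFin-update p (λ q q≢p → off (inj₁ q) (q≢p ∘ inj₁-injective)) at-v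
  lines  = sumFin-cong (λ ℓ → off (inj₂ ℓ) λ ())
sumV-update {f = f} {g} {a} {b} (inj₂ ℓ) off at-v = begin
  sumFin (f ∘ inj₁) + sumFin (f ∘ inj₂) + a    ≡⟨ +-assoc (sumFin (f ∘ inj₁)) _ a ⟩
  sumFin (f ∘ inj₁) + (sumFin (f ∘ inj₂) + a)  ≡⟨ cong₂ _+_ points lines ⟩
  sumFin (g ∘ inj₁) + (sumFin (g ∘ inj₂) + b)  ≡⟨ +-assoc (sumFin (g ∘ inj₁)) _ b ⟨
  sumFin (g ∘ inj₁) + sumFin (g ∘ inj₂) + b    ∎
  where
  open ≡-Reasoning
  points = sumFin-cong (λ p → off (inj₁ p) λ ())
  lines  = sumFin-update ℓ (λ m m≢ℓ → off (inj₂ m) (m≢ℓ ∘ inj₂-injective)) at-v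

sumE : (Edge np nl lam → ℕ) → ℕ
sumE F = sumFin λ p → sumFin λ ℓ → sumFin λ i → F (p , ℓ , i)

sumE-cong : {F G : Edge np nl lam → ℕ} → (∀ e → F e ≡ G e) → sumE F ≡ sumE G
sumE-cong F≗G = sumFin-cong λ p → sumFin-cong λ ℓ → sumFin-cong λ i → F≗G (p , ℓ , i)

sumE-mono : {F G : Edge np nl lam → ℕ} → (∀ e → F e ≤ G e) → sumE F ≤ sumE G
sumE-mono F≤G = sumFin-mono λ p → sumFin-mono λ ℓ → sumFin-mono λ i → F≤G (p , ℓ , i)

sumE-zero : sumE {np} {nl} {lam} (λ _ → 0) ≡ 0
sumE-zero {np} {nl} {lam} = trans
  (sumFin-cong {np} λ p → trans (sumFin-cong {nl} λ ℓ → sumFin-zero lam) (sumFin-zero nl))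
  (sumFin-zero np)

sumE-update : ∀ {F G : Edge np nl lam → ℕ} {a b} e → (∀ e' → e' ≢ e → F e' ≡ G e') →
              F e + a ≡ G e + b → sumE F + a ≡ sumE G + b
sumE-update (p , ℓ , i) off at-e =
  sumFin-update p
    (λ p' p'≢p → sumFin-cong λ ℓ' → sumFin-cong λ i' → off (p' , ℓ' , i') (p'≢p ∘ cong proj₁))
    (sumFin-update ℓ
      (λ ℓ' ℓ'≢ℓ → sumFin-cong λ i' → off (p , ℓ' , i') (ℓ'≢ℓ ∘ cong (proj₁ ∘ proj₂)))
      (sumFin-update i (λ i' i'≢i → off (p , ℓ , i') (i'≢i ∘ cong (proj₂ ∘ proj₂))) at-e))

edgeIn : Incidence np nl → Edge np nl lam → Bool
edgeIn J (p , ℓ , i) = J p ℓ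

sumE-χ-edgeIn : (J : Incidence np nl) → sumE {lam = lam} (χ ∘ edgeIn J) ≡ lam * card J
sumE-χ-edgeIn {np} {nl} {lam} J = begin
  sumFin (λ p → sumFin λ ℓ → sumFin {lam} λ _ → χ (J p ℓ))
    ≡⟨ sumFin-cong {np} (λ p → sumFin-cong {nl} λ ℓ → sumFin-const lam (χ (J p ℓ))) ⟩
  sumFin (λ p → sumFin λ ℓ → lam * χ (J p ℓ))
    ≡⟨ sumFin-cong (λ p → *-sumFin {nl} lam (χ ∘ J p)) ⟨
  sumFin (λ p → lam * sumFin (χ ∘ J p))
    ≡⟨ sumFin-cong (λ p → cong (lam *_) (countFin≡sumFin-χ (J p))) ⟨
  sumFin (λ p → lam * countFin (J p))
    ≡⟨ *-sumFin {np} lam (countFin ∘ J) ⟨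
  lam * card J
    ∎
  where open ≡-Reasoning

VertexSet : ℕ → ℕ → Set
VertexSet np nl = Vertex np nl → Bool

Orientation : ℕ → ℕ → ℕ → Set
Orientation np nl lam = Fin np → Fin nl → Fin lam → Orient

orientAt : Orientation np nl lam → Edge np nl lam → Orient
orientAt o (p , ℓ , i) = o p ℓ i

accepted : Orient → Bool
accepted unaccepted = false
accepted pt→ln      = true
accepted ln→pt      = true

tailIn : VertexSet np nl → Edge np nl lam → Orient → ℕ
tailIn S (p , ℓ , i) unaccepted = 0
tailIn S (p , ℓ , i) pt→ln      = χ (S (inj₁ p))
tailIn S (p , ℓ , i) ln→pt      = χ (S (inj₂ ℓ))

spanIn : VertexSet np nl → Edge np nl lam → Orient → ℕ
spanIn S (p , ℓ , i) z = χ (accepted z ∧ (S (inj₁ p) ∧ S (inj₂ ℓ)))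

tailsIn : VertexSet np nl → Orientation np nl lam → ℕ
tailsIn S o = sumE λ e → tailIn S e (orientAt o e)

spanned : VertexSet np nl → Orientation np nl lam → ℕ
spanned S o = sumE λ e → spanIn S e (orientAt o e)

pebblesOn : VertexSet np nl → (Vertex np nl → ℕ) → ℕ
pebblesOn S f = sumV λ x → if S x then f x else 0

support : Incidence np nl → VertexSet np nl
support J (inj₁ p) = anyFin (J p)
support J (inj₂ ℓ) = anyFin (λ p → J p ℓ)

capacity : ℕ → ℕ → VertexSet np nl → ℕ
capacity k₁ k₂ S = k₁ * countFin (S ∘ inj₁) + k₂ * countFin (S ∘ inj₂)

pebblesOn-initial : ∀ k₁ k₂ (S : VertexSet np nl) →
                    pebblesOn S (peb (initial np nl lam k₁ k₂)) ≡ capacity k₁ k₂ S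
pebblesOn-initial k₁ k₂ S =
  cong₂ _+_ (sumFin-if≡*-countFin (S ∘ inj₁) k₁) (sumFin-if≡*-countFin (S ∘ inj₂) k₂)

pebblesOn-update : ∀ S {f g : Vertex np nl → ℕ} {a b} v → (∀ x → x ≢ v → f x ≡ g x) →
                   (if S v then f v else 0) + a ≡ (if S v then g v else 0) + b →
                   pebblesOn S f + a ≡ pebblesOn S g + b
pebblesOn-update S {f} {g} v off at-v =
  sumV-update {f = λ x → if S x then f x else 0} {g = λ x → if S x then g x else 0} v
    (λ x x≢v → cong (λ m → if S x then m else 0) (off x x≢v)) at-v

pebblesOn-decr : ∀ S (f : Vertex np nl → ℕ) v → 0 < f v →
                 pebblesOn S (decr v f) + χ (S v) ≡ pebblesOn S f
pebblesOn-decr S f v 0<fv =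
  trans (pebblesOn-update S {decr v f} {f} v (λ x → if-≟V-off) at-v) (+-identityʳ _)
  where
  at-v : (if S v then decr v f v else 0) + χ (S v) ≡ (if S v then f v else 0) + 0
  at-v rewrite ≟V-refl v with S v
  ... | true  = trans (+-comm (pred (f v)) 1) (trans (suc-pred (f v) {{>-nonZero 0<fv}}) (sym (+-identityʳ _)))
  ... | false = refl

pebblesOn-incr : ∀ S (f : Vertex np nl → ℕ) v → pebblesOn S (incr v f) ≡ pebblesOn S f + χ (S v)
pebblesOn-incr S f v =
  trans (sym (+-identityʳ _)) (pebblesOn-update S {incr v f} {f} v (λ x → if-≟V-off) at-v)
  where
  at-v : (if S v then incr v f v else 0) + 0 ≡ (if S v then f v else 0) + χ (S v)
  at-v rewrite ≟V-refl v with S v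
  ... | true  = trans (+-identityʳ _) (+-comm 1 (f v))
  ... | false = refl

pebblesOn-move : ∀ S (f : Vertex np nl → ℕ) v w → 0 < f w →
                 pebblesOn S (incr v (decr w f)) + χ (S w) ≡ pebblesOn S f + χ (S v)
pebblesOn-move S f v w 0<fw = begin
  pebblesOn S (incr v (decr w f)) + χ (S w)       ≡⟨ cong (_+ χ (S w)) (pebblesOn-incr S (decr w f) v) ⟩
  pebblesOn S (decr w f) + χ (S v) + χ (S w)      ≡⟨ xy∙z≈xz∙y (pebblesOn S (decr w f)) _ _ ⟩
  pebblesOn S (decr w f) + χ (S w) + χ (S v)      ≡⟨ cong (_+ χ (S v)) (pebblesOn-decr S f w 0<fw) ⟩
  pebblesOn S f + χ (S v)                         ∎
  where open ≡-Reasoning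

spanIn≤tailIn : ∀ S (e : Edge np nl lam) z → spanIn S e z ≤ tailIn S e z
spanIn≤tailIn S (p , ℓ , i) unaccepted = z≤n
spanIn≤tailIn S (p , ℓ , i) pt→ln with S (inj₁ p) | S (inj₂ ℓ)
... | true  | true  = ≤-refl
... | true  | false = z≤n
... | false | _     = z≤n
spanIn≤tailIn S (p , ℓ , i) ln→pt with S (inj₁ p) | S (inj₂ ℓ)
... | true  | true  = ≤-refl
... | true  | false = z≤n
... | false | _     = z≤n

spanned≤tailsIn : ∀ S (o : Orientation np nl lam) → spanned S o ≤ tailsIn S o
spanned≤tailsIn S o = sumE-mono λ e → spanIn≤tailIn S e (orientAt o e)

pebbles≤pebblesOn : ∀ S (f : Vertex np nl → ℕ) p ℓ → S (inj₁ p) ≡ true → S (inj₂ ℓ) ≡ true →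
                    f (inj₁ p) + f (inj₂ ℓ) ≤ pebblesOn S f
pebbles≤pebblesOn S f p ℓ Sp Sℓ =
  +-mono-≤ (selected≤sumFin (S ∘ inj₁) (f ∘ inj₁) p Sp) (selected≤sumFin (S ∘ inj₂) (f ∘ inj₂) ℓ Sℓ)

setOrient : Edge np nl lam → Orient → Orientation np nl lam → Orientation np nl lam
setOrient e d o p ℓ i = if (p , ℓ , i) ≟E e then d else o p ℓ i

sumE-setOrient : (F : Edge np nl lam → Orient → ℕ) (o : Orientation np nl lam)
                 (e : Edge np nl lam) (d : Orient) →
                 F e unaccepted ≡ 0 → orientAt o e ≡ unaccepted →
                 sumE (λ e' → F e' (orientAt (setOrient e d o) e'))
                   ≡ sumE (λ e' → F e' (orientAt o e')) + F e d
sumE-setOrient F o e d F0 o[e] = trans (sym (+-identityʳ _))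
  (sumE-update e (λ e' e'≢e → cong (F e') (if-≟E-off e'≢e)) at-e)
  where
  at-e : F e (orientAt (setOrient e d o) e) + 0 ≡ F e (orientAt o e) + F e d
  at-e rewrite ≟E-refl e | o[e] | F0 = +-identityʳ _

sumE-reverseAlong-cons : (F : Edge np nl lam → Orient → ℕ) (o : Orientation np nl lam)
                         (e : Edge np nl lam) (es : List (Edge np nl lam)) {a b : ℕ} →
  elemE e es ≡ false → F e (flip (orientAt o e)) + a ≡ F e (orientAt o e) + b →
  sumE (λ e' → F e' (orientAt (reverseAlong (e ∷ es) o) e')) + a
    ≡ sumE (λ e' → F e' (orientAt (reverseAlong es o) e')) + b
sumE-reverseAlong-cons F o e es {a} {b} e∉es at-e = sumE-update e off at-e′
  where
  off : ∀ e' → e' ≢ e →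
        F e' (orientAt (reverseAlong (e ∷ es) o) e') ≡ F e' (orientAt (reverseAlong es o) e')
  off e' e'≢e with e' ≟E e in eq
  ... | true  = contradiction (≟E-true⇒≡ eq) e'≢e
  ... | false = refl
  at-e′ : F e (orientAt (reverseAlong (e ∷ es) o) e) + a ≡ F e (orientAt (reverseAlong es o) e) + b
  at-e′ rewrite ≟E-refl e | e∉es = at-e

source∈walkVerts : ∀ {c : Config np nl lam} {u w} (ws : Walk c u w) → u ∈ walkVerts ws
source∈walkVerts []      = here refl
source∈walkVerts (_ ∷ _) = here refl

endpoints∈walkVerts : ∀ {c : Config np nl lam} {u w} (ws : Walk c u w) p ℓ i →
  elemE (p , ℓ , i) (walkEdges ws) ≡ true → inj₁ p ∈ walkVerts ws × inj₂ ℓ ∈ walkVerts ws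
endpoints∈walkVerts (a ∷ ws) p ℓ i h with (p , ℓ , i) ≟E arcEdge a in eq
... | false = let p∈ , ℓ∈ = endpoints∈walkVerts ws p ℓ i h in there p∈ , there ℓ∈
endpoints∈walkVerts (arcPL p' ℓ' i' _ ∷ ws) p ℓ i h | true with ≟E-true⇒≡ {e = p , ℓ , i} {p' , ℓ' , i'} eq
... | refl = here refl , there (source∈walkVerts ws)
endpoints∈walkVerts (arcLP p' ℓ' i' _ ∷ ws) p ℓ i h | true with ≟E-true⇒≡ {e = p , ℓ , i} {p' , ℓ' , i'} eq
... | refl = there (source∈walkVerts ws) , here refl

arcEdge∉walkEdges : ∀ {c : Config np nl lam} {u x w} (a : Arc c u x) (ws : Walk c x w) →
                    All (u ≢_) (walkVerts ws) → elemE (arcEdge a) (walkEdges ws) ≡ false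
arcEdge∉walkEdges a ws u∉ws with elemE (arcEdge a) (walkEdges ws) in eq
... | false = refl
arcEdge∉walkEdges (arcPL p ℓ i _) ws u∉ws | true =
  contradiction refl (lookup u∉ws (proj₁ (endpoints∈walkVerts ws p ℓ i eq)))
arcEdge∉walkEdges (arcLP p ℓ i _) ws u∉ws | true =
  contradiction refl (lookup u∉ws (proj₂ (endpoints∈walkVerts ws p ℓ i eq)))

-- Reversing an arc u → x moves one tail from u to x; along a path no edge is reversed twice.
tailsIn-reverseAlong : ∀ {c : Config np nl lam} {u w} (π : Walk c u w) → IsPath π → ∀ S →
  tailsIn S (reverseAlong (walkEdges π) (orient c)) + χ (S u) ≡ tailsIn S (orient c) + χ (S w)
tailsIn-reverseAlong []       _               S = refl
tailsIn-reverseAlong {c = c} (a ∷ ws) (u∉ws ∷ path) S = trans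
  (sumE-reverseAlong-cons (tailIn S) (orient c) (arcEdge a) (walkEdges ws)
     (arcEdge∉walkEdges a ws u∉ws) (reverse-arc a))
  (tailsIn-reverseAlong ws path S)
  where
  reverse-arc : ∀ {u x} (a : Arc c u x) →
    tailIn S (arcEdge a) (flip (orientAt (orient c) (arcEdge a))) + χ (S u)
      ≡ tailIn S (arcEdge a) (orientAt (orient c) (arcEdge a)) + χ (S x)
  reverse-arc (arcPL p ℓ i o≡) rewrite o≡ = +-comm (χ (S (inj₂ ℓ))) _
  reverse-arc (arcLP p ℓ i o≡) rewrite o≡ = +-comm (χ (S (inj₁ p))) _

accepted-flipIf : ∀ b z → accepted (if b then flip z else z) ≡ accepted z
accepted-flipIf false z          = refl
accepted-flipIf true  unaccepted = refl
accepted-flipIf true  pt→ln      = refl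
accepted-flipIf true  ln→pt      = refl

spanned-reverseAlong : ∀ S es (o : Orientation np nl lam) → spanned S (reverseAlong es o) ≡ spanned S o
spanned-reverseAlong S es o = sumE-cong λ (p , ℓ , i) →
  cong (λ a → χ (a ∧ (S (inj₁ p) ∧ S (inj₂ ℓ)))) (accepted-flipIf (elemE (p , ℓ , i) es) (o p ℓ i))

-- The invariant of the pebble game

module PebbleGame {np nl lam : ℕ} (I : Incidence np nl) (k₁ k₂ l : ℕ) where

  record Invariant (c : Config np nl lam) : Set where
    field
      conservation : ∀ S → tailsIn S (orient c) + pebblesOn S (peb c) ≡ capacity k₁ k₂ S
      spanned+l≤capacity : ∀ S → 1 ≤ spanned S (orient c) →
                           spanned S (orient c) + l ≤ capacity k₁ k₂ S
      accepted⇒incident : ∀ p ℓ i → I p ℓ ≡ false → accepted (orient c p ℓ i) ≡ false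
  open Invariant

  initial-invariant : Invariant (initial np nl lam k₁ k₂)
  initial-invariant .conservation S =
    cong₂ _+_ (sumE-zero {np} {nl} {lam}) (pebblesOn-initial {lam = lam} k₁ k₂ S)
  initial-invariant .spanned+l≤capacity S 1≤0 with () ← subst (1 ≤_) (sumE-zero {np} {nl} {lam}) 1≤0
  initial-invariant .accepted⇒incident p ℓ i _ = refl

  -- Acceptance needs more than l pebbles on the endpoints, all of which count towards the capacity of S.
  accept-preserves : ∀ {c : Config np nl lam} {p ℓ i} d v →
    (∀ S → tailIn S (p , ℓ , i) d ≡ χ (S v)) → accepted d ≡ true →
    I p ℓ ≡ true → orient c p ℓ i ≡ unaccepted →
    l < peb c (inj₁ p) + peb c (inj₂ ℓ) → 0 < peb c v → Invariant c →
    Invariant (config (setOrient (p , ℓ , i) d (orient c)) (decr v (peb c)))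
  accept-preserves {c} {p} {ℓ} {i} d v tail≡ d-accepted Ipℓ unacc l<peb 0<peb inv = record
    { conservation       = conservation′
    ; spanned+l≤capacity = span-bound
    ; accepted⇒incident  = accepted-off
    }
    where
    e = (p , ℓ , i)
    o = orient c
    o′ = setOrient e d o

    conservation′ : ∀ S → tailsIn S o′ + pebblesOn S (decr v (peb c)) ≡ capacity k₁ k₂ S
    conservation′ S = trans
      (+-exchange {tailsIn S o′} {tailsIn S o} {pebblesOn S (decr v (peb c))} {pebblesOn S (peb c)}
                  (trans (+-identityʳ _) (trans (sumE-setOrient (tailIn S) o e d refl unacc)
                                                (cong (tailsIn S o +_) (tail≡ S))))
                  (trans (pebblesOn-decr S (peb c) v 0<peb) (sym (+-identityʳ _))))
      (conservation inv S)

    spanned-o′ : ∀ S → spanned S o′ ≡ spanned S o + χ (S (inj₁ p) ∧ S (inj₂ ℓ))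
    spanned-o′ S = trans (sumE-setOrient (spanIn S) o e d refl unacc)
      (cong (λ a → spanned S o + χ (a ∧ (S (inj₁ p) ∧ S (inj₂ ℓ)))) d-accepted)

    unchanged : ∀ S → spanned S o′ ≡ spanned S o + 0 →
                1 ≤ spanned S o′ → spanned S o′ + l ≤ capacity k₁ k₂ S
    unchanged S sp≡ 1≤sp rewrite sp≡ | +-identityʳ (spanned S o) = spanned+l≤capacity inv S 1≤sp

    span-bound : ∀ S → 1 ≤ spanned S o′ → spanned S o′ + l ≤ capacity k₁ k₂ S
    span-bound S with S (inj₁ p) in Sp | S (inj₂ ℓ) in Sℓ | spanned-o′ S
    ... | true | true | sp≡ = λ _ → begin
      spanned S o′ + l
        ≡⟨ cong (_+ l) sp≡ ⟩
      spanned S o + 1 + l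
        ≡⟨ +-assoc (spanned S o) 1 l ⟩
      spanned S o + suc l
        ≤⟨ +-mono-≤ (spanned≤tailsIn S o) l<peb ⟩
      tailsIn S o + (peb c (inj₁ p) + peb c (inj₂ ℓ))
        ≤⟨ +-monoʳ-≤ (tailsIn S o) (pebbles≤pebblesOn S (peb c) p ℓ Sp Sℓ) ⟩
      tailsIn S o + pebblesOn S (peb c)
        ≡⟨ conservation inv S ⟩
      capacity k₁ k₂ S
        ∎
      where open ≤-Reasoning
    ... | true  | false | sp≡ = unchanged S sp≡
    ... | false | _     | sp≡ = unchanged S sp≡

    accepted-off : ∀ p' ℓ' i' → I p' ℓ' ≡ false → accepted (o′ p' ℓ' i') ≡ false
    accepted-off p' ℓ' i' Ip'ℓ' =
      trans (cong accepted (if-≟E-off e'≢e)) (accepted⇒incident inv p' ℓ' i' Ip'ℓ')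
      where
      e'≢e : (p' , ℓ' , i') ≢ e
      e'≢e refl = contradiction (trans (sym Ipℓ) Ip'ℓ') λ ()

  move-preserves : ∀ {c : Config np nl lam} v w (π : Walk c v w) → IsPath π → 0 < peb c w → Invariant c →
    Invariant (config (reverseAlong (walkEdges π) (orient c)) (incr v (decr w (peb c))))
  move-preserves {c} v w π path 0<peb inv = record
    { conservation       = conservation′
    ; spanned+l≤capacity = λ S → subst (λ s → 1 ≤ s → s + l ≤ capacity k₁ k₂ S)
        (sym (spanned-reverseAlong S (walkEdges π) (orient c))) (spanned+l≤capacity inv S)
    ; accepted⇒incident  = λ p ℓ i Ipℓ →
        trans (accepted-flipIf (elemE (p , ℓ , i) (walkEdges π)) (orient c p ℓ i))
              (accepted⇒incident inv p ℓ i Ipℓ)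
    }
    where
    o′ = reverseAlong (walkEdges π) (orient c)
    peb′ = incr v (decr w (peb c))

    conservation′ : ∀ S → tailsIn S o′ + pebblesOn S peb′ ≡ capacity k₁ k₂ S
    conservation′ S = trans
      (+-exchange {tailsIn S o′} {tailsIn S (orient c)} {pebblesOn S peb′} {pebblesOn S (peb c)}
                  (tailsIn-reverseAlong π path S) (pebblesOn-move S (peb c) v w 0<peb))
      (conservation inv S)

  reachable⇒invariant : ∀ {c} → Reachable I k₁ k₂ l c → Invariant c
  reachable⇒invariant start = initial-invariant
  reachable⇒invariant (step r (acceptFromPoint c p ℓ i Ipℓ unacc l<peb 0<peb)) =
    accept-preserves pt→ln (inj₁ p) (λ _ → refl) refl Ipℓ unacc l<peb 0<peb (reachable⇒invariant r)
  reachable⇒invariant (step r (acceptFromLine c p ℓ i Ipℓ unacc l<peb 0<peb)) =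
    accept-preserves ln→pt (inj₂ ℓ) (λ _ → refl) refl Ipℓ unacc l<peb 0<peb (reachable⇒invariant r)
  reachable⇒invariant (step r (movePebble c v w π path 0<peb)) =
    move-preserves v w π path 0<peb (reachable⇒invariant r)

  module _ {c : Config np nl lam} (inv : Invariant c) (all-accepted : AllAccepted I c) where

    accepted≡incident : ∀ p ℓ i → accepted (orient c p ℓ i) ≡ I p ℓ
    accepted≡incident p ℓ i with I p ℓ in Ipℓ | orient c p ℓ i in o≡
    ... | false | _          = trans (sym (cong accepted o≡)) (accepted⇒incident inv p ℓ i Ipℓ)
    ... | true  | unaccepted = contradiction o≡ (all-accepted p ℓ i Ipℓ)
    ... | true  | pt→ln      = refl
    ... | true  | ln→pt      = refl

    *-card≤spanned-support : ∀ J → J ⊆I I → lam * card J ≤ spanned (support J) (orient c)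
    *-card≤spanned-support J J⊆I = begin
      lam * card J                   ≡⟨ sumE-χ-edgeIn {lam = lam} J ⟨
      sumE {lam = lam} (χ ∘ edgeIn J) ≤⟨ sumE-mono edge≤ ⟩
      spanned (support J) (orient c) ∎
      where
      open ≤-Reasoning
      edge≤ : ∀ e → χ (edgeIn J e) ≤ spanIn (support J) e (orientAt (orient c) e)
      edge≤ (p , ℓ , i) with J p ℓ in Jpℓ
      ... | false = z≤n
      ... | true rewrite accepted≡incident p ℓ i | J⊆I p ℓ Jpℓ
                       | anyFin-witness (J p) ℓ Jpℓ | anyFin-witness (λ q → J q ℓ) p Jpℓ = ≤-refl

    -- l ≤ k₁ + k₂ covers the J spanning no accepted edge, which occur only when λ = 0.
    sparse : l ≤ k₁ + k₂ → Sparse np nl I lam k₁ k₂ l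
    sparse l≤k₁+k₂ J J⊆I (p , ℓ , Jpℓ) =
      bounded-by-span (*-card≤spanned-support J J⊆I) l≤capacity (spanned+l≤capacity inv (support J))
      where
      l≤capacity : l ≤ k₁ * cardP J + k₂ * cardL J
      l≤capacity = ≤-trans l≤k₁+k₂
        (+-mono-≤ (m≤m*n k₁ (cardP J) {{>-nonZero 1≤cardP}}) (m≤m*n k₂ (cardL J) {{>-nonZero 1≤cardL}}))
        where
        1≤cardP = 1≤countFin (support J ∘ inj₁) p (anyFin-witness (J p) ℓ Jpℓ)
        1≤cardL = 1≤countFin (support J ∘ inj₂) ℓ (anyFin-witness (λ q → J q ℓ) p Jpℓ)

    card+totalPebbles≡capacity : lam * card I + totalPebbles c ≡ k₁ * np + k₂ * nl
    card+totalPebbles≡capacity = begin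
      lam * card I + totalPebbles c
        ≡⟨ cong (_+ totalPebbles c) (trans (sym (sumE-χ-edgeIn {lam = lam} I)) (sumE-cong tail≡)) ⟩
      tailsIn everything (orient c) + totalPebbles c
        ≡⟨ conservation inv everything ⟩
      capacity k₁ k₂ everything
        ≡⟨ cong₂ (λ a b → k₁ * a + k₂ * b) (countFin-true np) (countFin-true nl) ⟩
      k₁ * np + k₂ * nl
        ∎
      where
      open ≡-Reasoning
      everything : VertexSet np nl
      everything _ = true
      tail≡ : ∀ e → χ (edgeIn I e) ≡ tailIn everything e (orientAt (orient c) e)
      tail≡ (p , ℓ , i) with orient c p ℓ i | accepted≡incident p ℓ i
      ... | unaccepted | I≡ = cong χ (sym I≡)
      ... | pt→ln      | I≡ = cong χ (sym I≡)
      ... | ln→pt      | I≡ = cong χ (sym I≡)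

corollary2 : (np nl : ℕ) (I : Incidence np nl) (lam k₁ k₂ l : ℕ) →
    lam + l ≤ k₁ + k₂ →
    (c : Config np nl lam) → Reachable I k₁ k₂ l c → AllAccepted I c →
    Sparse np nl I lam k₁ k₂ l × (totalPebbles c ≡ l → Tight np nl I lam k₁ k₂ l)
corollary2 np nl I lam k₁ k₂ l lam+l≤k₁+k₂ c reachable all-accepted =
  is-sparse , λ total≡l →
    is-sparse , trans (cong (lam * card I +_) (sym total≡l)) (card+totalPebbles≡capacity inv all-accepted)
  where
  open PebbleGame {lam = lam} I k₁ k₂ l
  inv = reachable⇒invariant reachable
  is-sparse = sparse inv all-accepted (m+n≤o⇒n≤o lam lam+l≤k₁+k₂)
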